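{- Let $k$ be a positive integer. If there exist an even integer $u\ge2$ and an integer $t\ge2$ such that $L_{u+t+2}(k)=1\,1\,0^t\,1^u$ and $U_{2u-1}(k)=1^u\,0^{u-1}$, then $f(k)<k$.
   Context: $s_2(n)$ is the binary sum of digits of $n\ge0$, $t_n=s_2(n)\bmod 2$, and $f(k)=\min\{n\ge0: t_{kn}=1\}$ for $k\ge1$. If $k=\sum_{i=0}^{\ell-1}\varepsilon_i 2^i$ with $\varepsilon_i\in\{0,1\}$, $\varepsilon_{\ell-1}=1$, then $\ell=\ell(k)$ is the binary length; for $1\le j\le \ell(k)$, $L_j(k)=\varepsilon_{j-1}\cdots\varepsilon_0$ is the word of the $j$ least significant binary digits and $U_j(k)=\varepsilon_{\ell-1}\cdots\varepsilon_{\ell-j}$ is the word of the $j$ most significant binary digits (use of $L_j(k)$ or $U_j(k)$ presupposes $\ell(k)\ge j$). For $a\in\{0,1\}$, $a^n$ denotes the word consisting of $n$ copies of $a$ ($a^0$ is empty); juxtaposition denotes concatenation. -}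

module Defs where

open import Data.Nat using (ℕ; zero; suc; _+_; _*_; _<_; _≤_)
open import Data.Nat.DivMod using (_/_; _%_)
open import Data.Bool using (Bool; true; false)
open import Data.List using (List; []; _∷_; _++_; reverse; take; length; replicate)
open import Data.Product using (_×_)
open import Data.Nat.ListAction using (sum)
open import Relation.Binary.PropositionalEquality using (_≡_)

-- binary digits of n, least significant first (fuel = n suffices, since n/2 < n)
bitsLSB-aux : ℕ → ℕ → List Bool
bitsLSB-aux zero    n = []
bitsLSB-aux (suc f) zero = []
bitsLSB-aux (suc f) n@(suc _) = (n % 2 Data.Nat.≡ᵇ 1) ∷ bitsLSB-aux f (n / 2)

-- ε₀ ε₁ … ε_{ℓ-1}  (empty for n = 0)
bitsLSB : ℕ → List Bool
bitsLSB n = bitsLSB-aux n n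

bitsMSB : ℕ → List Bool
bitsMSB n = reverse (bitsLSB n)

len : ℕ → ℕ
len n = length (bitsLSB n)

s2 : ℕ → ℕ
s2 n = sum (Data.List.map (λ b → Data.Bool.if b then 1 else 0) (bitsLSB n))

t : ℕ → ℕ
t n = s2 n % 2

IsF : ℕ → ℕ → Set
IsF k m = (t (k * m) ≡ 1) × (∀ n → n < m → t (k * n) ≡ 0)

-- words are written as lists, left to right; 1 = true, 0 = false
-- L_j(k) = ε_{j-1} ⋯ ε₀
L : ℕ → ℕ → List Bool
L j k = reverse (take j (bitsLSB k))

U : ℕ → ℕ → List Bool
U j k = take j (bitsMSB k)

pow : Bool → ℕ → List Bool
pow a n = replicate n a

-- Split the binary expansion of k as k = c + 2^j A, where A is formed by the m leading digits and
-- c by the j = ℓ(k) − m trailing digits, so c is odd. Then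
--   k (2^j − 1) = (2^j − c) + 2^j (k − A − 1),   with 0 < 2^j − c < 2^j,
-- and since the digits of 2^j − c are those of c − 1 complemented, s₂(k(2^j − 1)) + s₂(c) =
-- j + 1 + s₂(k − A − 1). The leading digits 1^u 0^(u−1) give A = 1, 2^u − 1 or 2^(u+1) − 2 for
-- m = 1, u, u + 1, and subtracting A + 1 only changes the trailing block 1 1 0^t 1^u, into
-- 1 1 0^t 1^(u−2) 0 1, 1 0 1^t 1^u or 1 0 1^t 0^u respectively. The digit sum s₂(k(2^j − 1)) is
-- then j + 1, j + u + t or j + t, and choosing m according to the parities of ℓ(k) and t makes it
-- odd, so that f(k) ≤ 2^j − 1 < 2^j ≤ k.

module Submission where

open import Defs
open import Data.Nat
  using (ℕ; zero; suc; _+_; _*_; _∸_; _<_; _≤_; _^_; _⊓_; z≤n; s≤s; _≡ᵇ_; parity)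
open import Data.Nat.Properties
open import Data.Nat.DivMod
  using (_/_; _%_; m/n<m; m%n<n; m≡m%n+[m/n]*n; m*n%n≡0; m*n/n≡m; [m+kn]%n≡m%n; [m+n]%n≡m%n;
         +-distrib-/-∣ʳ)
open import Data.Nat.Divisibility using (_∣_; divides; n∣m*n)
open import Data.Nat.ListAction using (sum)
open import Data.Nat.ListAction.Properties using (sum-++)
open import Data.Nat.Tactic.RingSolver using (solve-∀)
open import Data.Bool using (Bool; true; false; not; if_then_else_)
open import Data.List using (List; []; _∷_; _++_; reverse; take; drop; length; replicate; map)
open import Data.List.Properties
  using (map-++; length-map; length-replicate; ++-assoc; ++-identityʳ; ∷-injectiveˡ;
         take++drop≡id; take-take; length-drop; reverse-++; reverse-involutive; length-reverse;
         unfold-reverse)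
open import Data.Parity.Base as ℙ using (0ℙ; 1ℙ)
import Data.Parity.Properties as ℙ
open import Data.Product using (Σ; _×_; _,_)
open import Data.Sum using (_⊎_; inj₁; inj₂)
open import Data.Empty using (⊥-elim)
open import Relation.Binary.PropositionalEquality
  using (_≡_; refl; sym; trans; cong; cong₂; subst; module ≡-Reasoning)

bit : Bool → ℕ
bit b = if b then 1 else 0

value : List Bool → ℕ
value []       = 0
value (b ∷ bs) = bit b + value bs * 2

ones : List Bool → ℕ
ones bs = sum (map bit bs)

half-suc≤ : ∀ n → suc n / 2 ≤ n
half-suc≤ n = ≤-pred (m/n<m (suc n) 2 (s≤s (s≤s z≤n)))

bitsLSB-aux-fuel : ∀ f g n → n ≤ f → n ≤ g → bitsLSB-aux f n ≡ bitsLSB-aux g n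
bitsLSB-aux-fuel zero    zero    zero    _       _       = refl
bitsLSB-aux-fuel zero    (suc g) zero    _       _       = refl
bitsLSB-aux-fuel (suc f) zero    zero    _       _       = refl
bitsLSB-aux-fuel (suc f) (suc g) zero    _       _       = refl
bitsLSB-aux-fuel (suc f) (suc g) (suc n) (s≤s p) (s≤s q) =
  cong (_ ∷_) (bitsLSB-aux-fuel f g (suc n / 2) (≤-trans (half-suc≤ n) p) (≤-trans (half-suc≤ n) q))

value-bitsLSB-aux : ∀ f n → n ≤ f → value (bitsLSB-aux f n) ≡ n
value-bitsLSB-aux zero    zero    _       = refl
value-bitsLSB-aux (suc f) zero    _       = refl
value-bitsLSB-aux (suc f) (suc n) (s≤s p) = begin
  bit (suc n % 2 ≡ᵇ 1) + value (bitsLSB-aux f (suc n / 2)) * 2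
    ≡⟨ cong₂ (λ r q → r + q * 2) (bit-≡ᵇ1 (suc n % 2) (m%n<n (suc n) 2))
                                  (value-bitsLSB-aux f (suc n / 2) (≤-trans (half-suc≤ n) p)) ⟩
  suc n % 2 + suc n / 2 * 2
    ≡⟨ m≡m%n+[m/n]*n (suc n) 2 ⟨
  suc n ∎
  where
  open ≡-Reasoning
  bit-≡ᵇ1 : ∀ r → r < 2 → bit (r ≡ᵇ 1) ≡ r
  bit-≡ᵇ1 0 _ = refl
  bit-≡ᵇ1 1 _ = refl
  bit-≡ᵇ1 (suc (suc _)) (s≤s (s≤s ()))

value-bitsLSB : ∀ n → value (bitsLSB n) ≡ n
value-bitsLSB n = value-bitsLSB-aux n n ≤-refl

s2-suc : ∀ n → s2 (suc n) ≡ bit (suc n % 2 ≡ᵇ 1) + s2 (suc n / 2)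
s2-suc n = cong (λ bs → bit (suc n % 2 ≡ᵇ 1) + ones bs)
                (bitsLSB-aux-fuel n (suc n / 2) (suc n / 2) (half-suc≤ n) ≤-refl)

s2-bit+double : ∀ b v → s2 (bit b + v * 2) ≡ bit b + s2 v
s2-bit+double false zero    = refl
s2-bit+double false (suc v) = begin
  s2 (suc v * 2)
    ≡⟨ s2-suc (suc (v * 2)) ⟩
  bit (suc v * 2 % 2 ≡ᵇ 1) + s2 (suc v * 2 / 2)
    ≡⟨ cong₂ (λ r q → bit (r ≡ᵇ 1) + s2 q) (m*n%n≡0 (suc v) 2) (m*n/n≡m (suc v) 2) ⟩
  s2 (suc v) ∎
  where open ≡-Reasoning
s2-bit+double true v = begin
  s2 (1 + v * 2)
    ≡⟨ s2-suc (v * 2) ⟩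
  bit ((1 + v * 2) % 2 ≡ᵇ 1) + s2 ((1 + v * 2) / 2)
    ≡⟨ cong₂ (λ r q → bit (r ≡ᵇ 1) + s2 q) ([m+kn]%n≡m%n 1 v 2) odd-half ⟩
  1 + s2 v ∎
  where
  open ≡-Reasoning
  odd-half : (1 + v * 2) / 2 ≡ v
  odd-half = trans (+-distrib-/-∣ʳ 1 {v * 2} {2} (n∣m*n v)) (m*n/n≡m v 2)

s2-value : ∀ bs → s2 (value bs) ≡ ones bs
s2-value []       = refl
s2-value (b ∷ bs) = trans (s2-bit+double b (value bs)) (cong (bit b +_) (s2-value bs))

value-++ : ∀ bs cs → value (bs ++ cs) ≡ value bs + 2 ^ length bs * value cs
value-++ []       cs = sym (+-identityʳ (value cs))
value-++ (b ∷ bs) cs = begin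
  bit b + value (bs ++ cs) * 2
    ≡⟨ cong (λ v → bit b + v * 2) (value-++ bs cs) ⟩
  bit b + (value bs + 2 ^ length bs * value cs) * 2
    ≡⟨ regroup (bit b) (value bs) (2 ^ length bs) (value cs) ⟩
  bit b + value bs * 2 + 2 * 2 ^ length bs * value cs ∎
  where
  open ≡-Reasoning
  regroup : ∀ c v p w → c + (v + p * w) * 2 ≡ c + v * 2 + 2 * p * w
  regroup = solve-∀

ones-++ : ∀ bs cs → ones (bs ++ cs) ≡ ones bs + ones cs
ones-++ bs cs = trans (cong sum (map-++ bit bs cs)) (sum-++ (map bit bs) (map bit cs))

1+n*2+1≡[n+1]*2 : ∀ n → 1 + n * 2 + 1 ≡ (n + 1) * 2
1+n*2+1≡[n+1]*2 = solve-∀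

value-complement : ∀ bs → value bs + value (map not bs) + 1 ≡ 2 ^ length bs
value-complement []       = refl
value-complement (b ∷ bs) = begin
  bit b + value bs * 2 + (bit (not b) + value (map not bs) * 2) + 1
    ≡⟨ regroup (bit b) (bit (not b)) (value bs) (value (map not bs)) ⟩
  bit b + bit (not b) + (value bs + value (map not bs)) * 2 + 1
    ≡⟨ cong (λ c → c + (value bs + value (map not bs)) * 2 + 1) (bit+bit-not b) ⟩
  1 + (value bs + value (map not bs)) * 2 + 1
    ≡⟨ 1+n*2+1≡[n+1]*2 (value bs + value (map not bs)) ⟩
  (value bs + value (map not bs) + 1) * 2
    ≡⟨ cong (_* 2) (value-complement bs) ⟩
  2 ^ length bs * 2
    ≡⟨ *-comm (2 ^ length bs) 2 ⟩
  2 ^ length (b ∷ bs) ∎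
  where
  open ≡-Reasoning
  regroup : ∀ c c' v v' → c + v * 2 + (c' + v' * 2) + 1 ≡ c + c' + (v + v') * 2 + 1
  regroup = solve-∀
  bit+bit-not : ∀ b → bit b + bit (not b) ≡ 1
  bit+bit-not true  = refl
  bit+bit-not false = refl

ones-complement : ∀ bs → ones bs + ones (map not bs) ≡ length bs
ones-complement []           = refl
ones-complement (true ∷ bs)  = cong suc (ones-complement bs)
ones-complement (false ∷ bs) = trans (+-suc (ones bs) (ones (map not bs))) (cong suc (ones-complement bs))

-- The digits of 2^j − c are true ∷ map not B because c = value (true ∷ B) is odd.
value-mul-mersenne : ∀ B A D → value D + value A + 1 ≡ value ((true ∷ B) ++ A) →
  value ((true ∷ map not B) ++ D) + value ((true ∷ B) ++ A)
    ≡ value ((true ∷ B) ++ A) * 2 ^ suc (length B)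
value-mul-mersenne B A D borrow = begin
  value ((true ∷ map not B) ++ D) + value ((true ∷ B) ++ A)
    ≡⟨ cong₂ _+_ (value-++ (true ∷ map not B) D) (value-++ (true ∷ B) A) ⟩
  1 + f * 2 + 2 * 2 ^ length (map not B) * d + (1 + b * 2 + 2 * p * a)
    ≡⟨ cong (λ n → 1 + f * 2 + 2 * 2 ^ n * d + (1 + b * 2 + 2 * p * a)) (length-map not B) ⟩
  1 + f * 2 + 2 * p * d + (1 + b * 2 + 2 * p * a)
    ≡⟨ regroup b f p a d ⟩
  (b + f + 1) * 2 + 2 * p * (d + a)
    ≡⟨ cong (λ q → q * 2 + 2 * p * (d + a)) (value-complement B) ⟩
  p * 2 + 2 * p * (d + a)
    ≡⟨ factor p a d ⟩
  (d + a + 1) * (2 * p)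
    ≡⟨ cong (_* (2 * p)) borrow ⟩
  value ((true ∷ B) ++ A) * 2 ^ suc (length B) ∎
  where
  open ≡-Reasoning
  b f p a d : ℕ
  b = value B
  f = value (map not B)
  p = 2 ^ length B
  a = value A
  d = value D
  regroup : ∀ b f p a d →
    1 + f * 2 + 2 * p * d + (1 + b * 2 + 2 * p * a) ≡ (b + f + 1) * 2 + 2 * p * (d + a)
  regroup = solve-∀
  factor : ∀ p a d → p * 2 + 2 * p * (d + a) ≡ (d + a + 1) * (2 * p)
  factor = solve-∀

ones-complement-++ : ∀ B D → ones ((true ∷ map not B) ++ D) + ones B ≡ suc (length B) + ones D
ones-complement-++ B D = begin
  ones ((true ∷ map not B) ++ D) + ones B    ≡⟨ cong (_+ ones B) (ones-++ (true ∷ map not B) D) ⟩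
  1 + ones (map not B) + ones D + ones B     ≡⟨ regroup (ones B) (ones (map not B)) (ones D) ⟩
  1 + (ones B + ones (map not B)) + ones D   ≡⟨ cong (λ n → 1 + n + ones D) (ones-complement B) ⟩
  suc (length B) + ones D ∎
  where
  open ≡-Reasoning
  regroup : ∀ b b' d → 1 + b' + d + b ≡ 1 + (b + b') + d
  regroup = solve-∀

s2-mul-mersenne : ∀ B A D → value D + value A + 1 ≡ value ((true ∷ B) ++ A) →
  s2 (value ((true ∷ B) ++ A) * (2 ^ suc (length B) ∸ 1)) + ones B ≡ suc (length B) + ones D
s2-mul-mersenne B A D borrow = begin
  s2 (k * (2 ^ suc (length B) ∸ 1)) + ones B
    ≡⟨ cong (λ n → s2 n + ones B) product ⟩
  s2 (value X) + ones B
    ≡⟨ cong (_+ ones B) (s2-value X) ⟩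
  ones X + ones B
    ≡⟨ ones-complement-++ B D ⟩
  suc (length B) + ones D ∎
  where
  open ≡-Reasoning
  k : ℕ
  k = value ((true ∷ B) ++ A)
  X : List Bool
  X = (true ∷ map not B) ++ D
  product : k * (2 ^ suc (length B) ∸ 1) ≡ value X
  product = begin
    k * (2 ^ suc (length B) ∸ 1)
      ≡⟨ *-distribˡ-∸ k (2 ^ suc (length B)) 1 ⟩
    k * 2 ^ suc (length B) ∸ k * 1
      ≡⟨ cong₂ _∸_ (sym (value-mul-mersenne B A D borrow)) (*-identityʳ k) ⟩
    value X + k ∸ k
      ≡⟨ m+n∸n≡m (value X) k ⟩
    value X ∎

value-lower-borrow : ∀ low low' R a → length low' ≡ length low →
  value low' + a ≡ value low → value (low' ++ R) + a ≡ value (low ++ R)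
value-lower-borrow low low' R a same-length borrow = begin
  value (low' ++ R) + a
    ≡⟨ cong (_+ a) (value-++ low' R) ⟩
  value low' + 2 ^ length low' * value R + a
    ≡⟨ +-comm-middle (value low') _ a ⟩
  value low' + a + 2 ^ length low' * value R
    ≡⟨ cong₂ (λ v n → v + 2 ^ n * value R) borrow same-length ⟩
  value low + 2 ^ length low * value R
    ≡⟨ value-++ low R ⟨
  value (low ++ R) ∎
  where
  open ≡-Reasoning
  +-comm-middle : ∀ x y z → x + y + z ≡ x + z + y
  +-comm-middle = solve-∀

s2-mul-mersenne-borrow : ∀ B A low low' R e → (true ∷ B) ++ A ≡ low ++ R →
  length low' ≡ length low → value low' + value A + 1 ≡ value low →
  ones low' + ones A + 1 ≡ e + ones low →
  s2 (value (low ++ R) * (2 ^ suc (length B) ∸ 1)) ≡ suc (length B) + e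
s2-mul-mersenne-borrow B A low low' R e split same-length borrow ones-borrow =
  +-cancelʳ-≡ _ _ _ (begin
    S + ones ((true ∷ B) ++ A)              ≡⟨ cong (λ n → S + suc n) (ones-++ B A) ⟩
    S + suc (ones B + ones A)               ≡⟨ regroup₁ S (ones B) (ones A) ⟩
    S + ones B + 1 + ones A                 ≡⟨ cong (λ n → n + 1 + ones A) s2-identity ⟩
    j + ones (low' ++ R) + 1 + ones A       ≡⟨ cong (λ n → j + n + 1 + ones A) (ones-++ low' R) ⟩
    j + (ones low' + ones R) + 1 + ones A   ≡⟨ regroup₂ j (ones low') (ones R) (ones A) ⟩
    j + (ones low' + ones A + 1) + ones R   ≡⟨ cong (λ n → j + n + ones R) ones-borrow ⟩
    j + (e + ones low) + ones R             ≡⟨ regroup₃ j e (ones low) (ones R) ⟩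
    j + e + (ones low + ones R)             ≡⟨ cong (j + e +_) (ones-++ low R) ⟨
    j + e + ones (low ++ R)                 ≡⟨ cong (λ bs → j + e + ones bs) split ⟨
    j + e + ones ((true ∷ B) ++ A) ∎)
  where
  open ≡-Reasoning
  j S : ℕ
  j = suc (length B)
  S = s2 (value (low ++ R) * (2 ^ j ∸ 1))
  s2-identity : S + ones B ≡ j + ones (low' ++ R)
  s2-identity = subst (λ bs → s2 (value bs * (2 ^ j ∸ 1)) + ones B ≡ j + ones (low' ++ R)) split
    (s2-mul-mersenne B A (low' ++ R)
      (trans (+-assoc (value (low' ++ R)) (value A) 1)
        (trans (value-lower-borrow low low' R (value A + 1) same-length
                 (trans (sym (+-assoc (value low') (value A) 1)) borrow))
          (cong value (sym split)))))
  regroup₁ : ∀ s b a → s + suc (b + a) ≡ s + b + 1 + a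
  regroup₁ = solve-∀
  regroup₂ : ∀ j l r a → j + (l + r) + 1 + a ≡ j + (l + a + 1) + r
  regroup₂ = solve-∀
  regroup₃ : ∀ j e l r → j + (e + l) + r ≡ j + e + (l + r)
  regroup₃ = solve-∀

t≡0⊎t≡1 : ∀ n → t n ≡ 0 ⊎ t n ≡ 1
t≡0⊎t≡1 n with t n | m%n<n (s2 n) 2
... | 0           | _                 = inj₁ refl
... | 1           | _                 = inj₂ refl
... | suc (suc _) | s≤s (s≤s ())

first-odd-multiple : ∀ k N → (∀ n → n < N → t (k * n) ≡ 0) ⊎ Σ ℕ (λ m → IsF k m × m < N)
first-odd-multiple k zero = inj₁ (λ _ ())
first-odd-multiple k (suc N) with first-odd-multiple k N
... | inj₂ (m , f≡m , m<N) = inj₂ (m , f≡m , m<n⇒m<1+n m<N)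
... | inj₁ even-below with t≡0⊎t≡1 (k * N)
...   | inj₂ odd = inj₂ (N , (odd , even-below) , ≤-refl)
...   | inj₁ even = inj₁ even-up-to
  where
  even-up-to : ∀ n → n < suc N → t (k * n) ≡ 0
  even-up-to n (s≤s n≤N) with m≤n⇒m<n∨m≡n n≤N
  ... | inj₁ n<N  = even-below n n<N
  ... | inj₂ refl = even

f<k-from-witness : ∀ k n → n < k → t (k * n) ≡ 1 → Σ ℕ (λ m → IsF k m × m < k)
f<k-from-witness k n n<k odd with first-odd-multiple k k
... | inj₂ f<k      = f<k
... | inj₁ all-even with trans (sym odd) (all-even n n<k)
... | ()

parity≡1ℙ⇒%2≡1 : ∀ n → parity n ≡ 1ℙ → n % 2 ≡ 1
parity≡1ℙ⇒%2≡1 1             _   = refl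
parity≡1ℙ⇒%2≡1 (suc (suc n)) odd =
  trans (cong (_% 2) (+-comm 2 n)) (trans ([m+n]%n≡m%n n 2) (parity≡1ℙ⇒%2≡1 n odd))

parity-+-split : ∀ j m e → parity (j + e) ≡ parity (j + m) ℙ.+ parity (m + e)
parity-+-split j m e = begin
  parity (j + e)                             ≡⟨ ℙ.+-identityʳ (parity (j + e)) ⟨
  parity (j + e) ℙ.+ 0ℙ                      ≡⟨ cong (parity (j + e) ℙ.+_) (ℙ.p+p≡0ℙ (parity m)) ⟨
  parity (j + e) ℙ.+ (parity m ℙ.+ parity m) ≡⟨ cong (parity (j + e) ℙ.+_) (ℙ.+-homo-+ m m) ⟨
  parity (j + e) ℙ.+ parity (m + m)          ≡⟨ ℙ.+-homo-+ (j + e) (m + m) ⟨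
  parity (j + e + (m + m))                   ≡⟨ cong parity (regroup j m e) ⟩
  parity (j + m + (m + e))                   ≡⟨ ℙ.+-homo-+ (j + m) (m + e) ⟩
  parity (j + m) ℙ.+ parity (m + e) ∎
  where
  open ≡-Reasoning
  regroup : ∀ j m e → j + e + (m + m) ≡ j + m + (m + e)
  regroup = solve-∀

2^length≤value-++ : ∀ bs cs → 0 < value cs → 2 ^ length bs ≤ value (bs ++ cs)
2^length≤value-++ bs cs 0<c = begin
  2 ^ length bs                             ≡⟨ *-identityʳ (2 ^ length bs) ⟨
  2 ^ length bs * 1                         ≤⟨ *-monoʳ-≤ (2 ^ length bs) 0<c ⟩
  2 ^ length bs * value cs                  ≤⟨ m≤n+m _ (value bs) ⟩
  value bs + 2 ^ length bs * value cs       ≡⟨ value-++ bs cs ⟨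
  value (bs ++ cs) ∎
  where open ≤-Reasoning

f<k-by-borrowing : ∀ k B A low low' R e →
  (true ∷ B) ++ A ≡ bitsLSB k → low ++ R ≡ bitsLSB k →
  length low' ≡ length low → value low' + value A + 1 ≡ value low → 0 < value A →
  ones low' + ones A + 1 ≡ e + ones low → parity (suc (length B) + e) ≡ 1ℙ →
  Σ ℕ (λ m → IsF k m × m < k)
f<k-by-borrowing k B A low low' R e top-split low-split same-length borrow 0<A ones-borrow odd =
  f<k-from-witness k (J ∸ 1) (<-≤-trans J∸1<J J≤k) (begin
    s2 (k * (J ∸ 1)) % 2                 ≡⟨ cong (λ n → s2 (n * (J ∸ 1)) % 2) k≡ ⟩
    s2 (value (low ++ R) * (J ∸ 1)) % 2
      ≡⟨ cong (_% 2) (s2-mul-mersenne-borrow B A low low' R e (trans top-split (sym low-split))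
                                              same-length borrow ones-borrow) ⟩
    (suc (length B) + e) % 2             ≡⟨ parity≡1ℙ⇒%2≡1 (suc (length B) + e) odd ⟩
    1 ∎)
  where
  open ≡-Reasoning
  J : ℕ
  J = 2 ^ suc (length B)
  k≡ : k ≡ value (low ++ R)
  k≡ = trans (sym (value-bitsLSB k)) (cong value (sym low-split))
  J∸1<J : J ∸ 1 < J
  J∸1<J = ∸-monoʳ-< {o = 0} (s≤s z≤n) (m^n>0 2 (suc (length B)))
  J≤k : J ≤ k
  J≤k = subst (J ≤_) (trans (cong value top-split) (value-bitsLSB k))
              (2^length≤value-++ (true ∷ B) A 0<A)

reverse-replicate : ∀ {A : Set} n (a : A) → reverse (replicate n a) ≡ replicate n a
reverse-replicate zero    a = refl
reverse-replicate (suc n) a = begin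
  reverse (a ∷ replicate n a)       ≡⟨ unfold-reverse a (replicate n a) ⟩
  reverse (replicate n a) ++ a ∷ [] ≡⟨ cong (_++ a ∷ []) (reverse-replicate n a) ⟩
  replicate n a ++ a ∷ []           ≡⟨ replicate-snoc n ⟩
  a ∷ replicate n a ∎
  where
  open ≡-Reasoning
  replicate-snoc : ∀ n → replicate n a ++ a ∷ [] ≡ a ∷ replicate n a
  replicate-snoc zero    = refl
  replicate-snoc (suc n) = cong (a ∷_) (replicate-snoc n)

take-replicate-++ : ∀ {A : Set} n i (a : A) ys →
  take (n + i) (replicate n a ++ ys) ≡ replicate n a ++ take i ys
take-replicate-++ zero    i a ys = refl
take-replicate-++ (suc n) i a ys = cong (a ∷_) (take-replicate-++ n i a ys)

length-replicate-++ : ∀ {A : Set} n (a b : A) xs ys → length xs ≡ length ys →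
  length (replicate n a ++ xs) ≡ length (replicate n b ++ ys)
length-replicate-++ zero    a b xs ys same = same
length-replicate-++ (suc n) a b xs ys same = cong suc (length-replicate-++ n a b xs ys same)

take-of-take : ∀ {A : Set} {m n} (xs ys : List A) → m ≤ n → take n xs ≡ ys → take m xs ≡ take m ys
take-of-take {m = m} {n} xs ys m≤n eq = begin
  take m xs          ≡⟨ cong (λ i → take i xs) (m≤n⇒m⊓n≡m m≤n) ⟨
  take (m ⊓ n) xs    ≡⟨ take-take m n xs ⟨
  take m (take n xs) ≡⟨ cong (take m) eq ⟩
  take m ys ∎
  where open ≡-Reasoning

msb-split : ∀ {A : Set} m (x : A) xs ys → x ∷ xs ≡ ys → m < length ys →
  Σ (List A) (λ B → (x ∷ B) ++ reverse (take m (reverse ys)) ≡ ys × suc (length B) + m ≡ length ys)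
msb-split m x xs ys refl m<len = split (reverse (drop m (reverse ys))) lsb++msb lsb-length
  where
  msb : List _
  msb = reverse (take m (reverse ys))
  lsb++msb : reverse (drop m (reverse ys)) ++ msb ≡ ys
  lsb++msb = begin
    reverse (drop m (reverse ys)) ++ msb
      ≡⟨ reverse-++ (take m (reverse ys)) (drop m (reverse ys)) ⟨
    reverse (take m (reverse ys) ++ drop m (reverse ys))
      ≡⟨ cong reverse (take++drop≡id m (reverse ys)) ⟩
    reverse (reverse ys)
      ≡⟨ reverse-involutive ys ⟩
    ys ∎
    where open ≡-Reasoning
  lsb-length : length (reverse (drop m (reverse ys))) ≡ length ys ∸ m
  lsb-length = trans (length-reverse (drop m (reverse ys)))
                     (trans (length-drop m (reverse ys)) (cong (_∸ m) (length-reverse ys)))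
  split : ∀ lsb → lsb ++ msb ≡ ys → length lsb ≡ length ys ∸ m →
    Σ (List _) (λ B → (x ∷ B) ++ msb ≡ ys × suc (length B) + m ≡ length ys)
  split []      _  len = ⊥-elim (<⇒≱ m<len (m∸n≡0⇒m≤n (sym len)))
  split (c ∷ B) eq len with ∷-injectiveˡ eq
  ... | refl = B , eq , trans (cong (_+ m) len) (m∸n+n≡m (<⇒≤ m<len))

value-replicate-true : ∀ n → value (replicate n true) + 1 ≡ 2 ^ n
value-replicate-true zero    = refl
value-replicate-true (suc n) = begin
  1 + value (replicate n true) * 2 + 1 ≡⟨ 1+n*2+1≡[n+1]*2 (value (replicate n true)) ⟩
  (value (replicate n true) + 1) * 2   ≡⟨ cong (_* 2) (value-replicate-true n) ⟩
  2 ^ n * 2                            ≡⟨ *-comm (2 ^ n) 2 ⟩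
  2 ^ suc n ∎
  where open ≡-Reasoning

value-replicate-false : ∀ n → value (replicate n false) ≡ 0
value-replicate-false zero    = refl
value-replicate-false (suc n) = cong (_* 2) (value-replicate-false n)

value-replicate-++ : ∀ n a ys → value (replicate n a ++ ys) ≡ value (replicate n a) + 2 ^ n * value ys
value-replicate-++ n a ys =
  trans (value-++ (replicate n a) ys)
        (cong (λ l → value (replicate n a) + 2 ^ l * value ys) (length-replicate n))

value-carry : ∀ n ys →
  value (replicate n true ++ false ∷ ys) + 1 ≡ value (replicate n false ++ true ∷ ys)
value-carry zero    ys = +-comm (value ys * 2) 1
value-carry (suc n) ys = begin
  1 + value (replicate n true ++ false ∷ ys) * 2 + 1
    ≡⟨ 1+n*2+1≡[n+1]*2 (value (replicate n true ++ false ∷ ys)) ⟩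
  (value (replicate n true ++ false ∷ ys) + 1) * 2
    ≡⟨ cong (_* 2) (value-carry n ys) ⟩
  value (replicate n false ++ true ∷ ys) * 2 ∎
  where open ≡-Reasoning

ones-replicate-true : ∀ n → ones (replicate n true) ≡ n
ones-replicate-true zero    = refl
ones-replicate-true (suc n) = cong suc (ones-replicate-true n)

ones-replicate-false : ∀ n → ones (replicate n false) ≡ 0
ones-replicate-false zero    = refl
ones-replicate-false (suc n) = ones-replicate-false n

reverse-trailing-block : ∀ u t' → reverse (true ∷ true ∷ (replicate t' false ++ replicate u true))
                                  ≡ replicate u true ++ replicate t' false ++ true ∷ true ∷ []
reverse-trailing-block u t' = begin
  reverse ((true ∷ true ∷ []) ++ replicate t' false ++ replicate u true)
    ≡⟨ reverse-++ (true ∷ true ∷ []) (replicate t' false ++ replicate u true) ⟩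
  reverse (replicate t' false ++ replicate u true) ++ true ∷ true ∷ []
    ≡⟨ cong (_++ true ∷ true ∷ []) (reverse-++ (replicate t' false) (replicate u true)) ⟩
  (reverse (replicate u true) ++ reverse (replicate t' false)) ++ true ∷ true ∷ []
    ≡⟨ cong₂ (λ xs ys → (xs ++ ys) ++ true ∷ true ∷ [])
             (reverse-replicate u true) (reverse-replicate t' false) ⟩
  (replicate u true ++ replicate t' false) ++ true ∷ true ∷ []
    ≡⟨ ++-assoc (replicate u true) (replicate t' false) (true ∷ true ∷ []) ⟩
  replicate u true ++ replicate t' false ++ true ∷ true ∷ [] ∎
  where open ≡-Reasoning

-- low is L_{u+t+2}(k) read from the least significant digit, so Z = 0^t 1 1 there, and W is what
-- Z becomes after subtracting 1; top-word is U_{2u−1}(k), most significant digit first.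
module Borrowing (k u₂ t' : ℕ) (R : List Bool) where

  u : ℕ
  u = suc (suc u₂)

  Z W low top-word : List Bool
  Z        = replicate t' false ++ true ∷ true ∷ []
  W        = replicate t' true ++ false ∷ true ∷ []
  low      = replicate u true ++ Z
  top-word = replicate u true ++ replicate (suc u₂) false

  V : ℕ
  V = value (replicate u true)

  value-low : V + 2 ^ u * value W + (V + 1) ≡ value low
  value-low = begin
    V + 2 ^ u * value W + (V + 1) ≡⟨ cong (V + 2 ^ u * value W +_) (value-replicate-true u) ⟩
    V + 2 ^ u * value W + 2 ^ u   ≡⟨ regroup V (2 ^ u) (value W) ⟩
    V + 2 ^ u * (value W + 1)     ≡⟨ cong (λ z → V + 2 ^ u * z) (value-carry t' (true ∷ [])) ⟩
    V + 2 ^ u * value Z           ≡⟨ value-replicate-++ u true Z ⟨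
    value low ∎
    where
    open ≡-Reasoning
    regroup : ∀ v p w → v + p * w + p ≡ v + p * (w + 1)
    regroup = solve-∀

  ones-low : ones low ≡ u + 2
  ones-low = trans (ones-++ (replicate u true) Z)
                   (cong₂ _+_ (ones-replicate-true u) ones-Z)
    where
    ones-Z : ones Z ≡ 2
    ones-Z = trans (ones-++ (replicate t' false) (true ∷ true ∷ [])) (cong (_+ 2) (ones-replicate-false t'))

  ones-W : ones W ≡ t' + 1
  ones-W = trans (ones-++ (replicate t' true) (false ∷ true ∷ [])) (cong (_+ 1) (ones-replicate-true t'))

  u+1≤2u∸1 : u + 1 ≤ 2 * u ∸ 1
  u+1≤2u∸1 = ≤-trans (m≤m+n (u + 1) u₂) (≤-reflexive (regroup u₂))
    where
    -- the right-hand side is what 2 * u ∸ 1 normalises to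
    regroup : ∀ x → suc (suc x) + 1 + x ≡ suc (x + suc (suc (x + 0)))
    regroup = solve-∀

  ones-replicate-++-W : ∀ b → ones (replicate u b ++ W) ≡ ones (replicate u b) + (t' + 1)
  ones-replicate-++-W b = trans (ones-++ (replicate u b) W) (cong (ones (replicate u b) +_) ones-W)

  length-W : length W ≡ length Z
  length-W = length-replicate-++ t' true false (false ∷ true ∷ []) (true ∷ true ∷ []) refl

  module _ (low-split : low ++ R ≡ bitsLSB k)
           (leading : take (2 * u ∸ 1) (reverse (bitsLSB k)) ≡ top-word)
           (long : u + t' + 2 ≤ len k) where

    u+2≤len : u + 2 ≤ len k
    u+2≤len = ≤-trans (+-monoˡ-≤ 2 (m≤m+n u t')) long

    leading-bits : ∀ {m A} → m ≤ u + 1 →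
      reverse (take m top-word) ≡ A → reverse (take m (reverse (bitsLSB k))) ≡ A
    leading-bits m≤u+1 msb = trans (cong reverse
      (take-of-take (reverse (bitsLSB k)) top-word (≤-trans m≤u+1 u+1≤2u∸1) leading)) msb

    f<k-by-borrowing-top : ∀ m A low' e → m ≤ u + 1 → reverse (take m top-word) ≡ A →
      length low' ≡ length low → value low' + value A + 1 ≡ value low → 0 < value A →
      ones low' + ones A + 1 ≡ e + ones low → (∀ j → j + m ≡ len k → parity (j + e) ≡ 1ℙ) →
      Σ ℕ (λ n → IsF k n × n < k)
    f<k-by-borrowing-top m A low' e m≤u+1 msb same-length borrow 0<A ones-borrow odd
      with msb-split m true _ (bitsLSB k) low-split
             (≤-trans (s≤s m≤u+1) (subst (_≤ len k) (+-suc u 1) u+2≤len))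
    ... | B , split , lengths =
      f<k-by-borrowing k B A low low' R e top-split low-split same-length borrow 0<A ones-borrow
        (odd (suc (length B)) lengths)
      where
      top-split : (true ∷ B) ++ A ≡ bitsLSB k
      top-split = subst (λ A′ → (true ∷ B) ++ A′ ≡ bitsLSB k) (leading-bits m≤u+1 msb) split

    f<k-odd-length : parity (len k) ≡ 1ℙ → Σ ℕ (λ n → IsF k n × n < k)
    f<k-odd-length odd-length =
      f<k-by-borrowing-top 1 (true ∷ []) (true ∷ false ∷ rest) 1 (s≤s z≤n) refl refl
        (borrow (value rest)) (s≤s z≤n) (ones-borrow (ones rest))
        (λ j lengths → trans (cong parity lengths) odd-length)
      where
      rest : List Bool
      rest = replicate u₂ true ++ Z
      borrow : ∀ r → 1 + (0 + r * 2) * 2 + 1 + 1 ≡ 1 + (1 + r * 2) * 2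
      borrow = solve-∀
      ones-borrow : ∀ r → suc r + 1 + 1 ≡ 1 + suc (suc r)
      ones-borrow = solve-∀

    f<k-even-length-odd-gap : parity (len k) ≡ 0ℙ → parity t' ≡ 1ℙ → Σ ℕ (λ n → IsF k n × n < k)
    f<k-even-length-odd-gap even-length odd-gap =
      f<k-by-borrowing-top u (replicate u true) (replicate u true ++ W) (u + t') (m≤m+n u 1) msb
        (length-replicate-++ u true true W Z length-W) borrow (s≤s z≤n) ones-borrow odd
      where
      open ≡-Reasoning
      msb : reverse (take u top-word) ≡ replicate u true
      msb = begin
        reverse (take u top-word)
          ≡⟨ cong (λ i → reverse (take i top-word)) (+-identityʳ u) ⟨
        reverse (take (u + 0) top-word)
          ≡⟨ cong reverse (take-replicate-++ u 0 true (replicate (suc u₂) false)) ⟩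
        reverse (replicate u true ++ [])
          ≡⟨ cong reverse (++-identityʳ (replicate u true)) ⟩
        reverse (replicate u true)
          ≡⟨ reverse-replicate u true ⟩
        replicate u true ∎
      borrow : value (replicate u true ++ W) + V + 1 ≡ value low
      borrow = begin
        value (replicate u true ++ W) + V + 1 ≡⟨ cong (λ x → x + V + 1) (value-replicate-++ u true W) ⟩
        V + 2 ^ u * value W + V + 1           ≡⟨ +-assoc (V + 2 ^ u * value W) V 1 ⟩
        V + 2 ^ u * value W + (V + 1)         ≡⟨ value-low ⟩
        value low ∎
      ones-borrow : ones (replicate u true ++ W) + ones (replicate u true) + 1 ≡ u + t' + ones low
      ones-borrow = begin
        ones (replicate u true ++ W) + ones (replicate u true) + 1
          ≡⟨ cong₂ (λ x y → x + y + 1) (ones-replicate-++-W true) (ones-replicate-true u) ⟩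
        ones (replicate u true) + (t' + 1) + u + 1
          ≡⟨ cong (λ x → x + (t' + 1) + u + 1) (ones-replicate-true u) ⟩
        u + (t' + 1) + u + 1
          ≡⟨ regroup u t' ⟩
        u + t' + (u + 2)
          ≡⟨ cong (u + t' +_) ones-low ⟨
        u + t' + ones low ∎
        where
        regroup : ∀ u t' → u + (t' + 1) + u + 1 ≡ u + t' + (u + 2)
        regroup = solve-∀
      odd : ∀ j → j + u ≡ len k → parity (j + (u + t')) ≡ 1ℙ
      odd j lengths = begin
        parity (j + (u + t'))        ≡⟨ cong parity (+-assoc j u t') ⟨
        parity (j + u + t')          ≡⟨ ℙ.+-homo-+ (j + u) t' ⟩
        parity (j + u) ℙ.+ parity t' ≡⟨ cong₂ ℙ._+_ (trans (cong parity lengths) even-length) odd-gap ⟩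
        1ℙ ∎

    f<k-even-length-even-gap : 2 ∣ u → parity (len k) ≡ 0ℙ → parity t' ≡ 0ℙ →
      Σ ℕ (λ n → IsF k n × n < k)
    f<k-even-length-even-gap (divides a u≡a*2) even-length even-gap =
      f<k-by-borrowing-top (u + 1) (false ∷ replicate u true) (replicate u false ++ W) t' ≤-refl msb
        (length-replicate-++ u false true W Z length-W) borrow (s≤s z≤n) ones-borrow odd
      where
      open ≡-Reasoning
      msb : reverse (take (u + 1) top-word) ≡ false ∷ replicate u true
      msb = begin
        reverse (take (u + 1) top-word)
          ≡⟨ cong reverse (take-replicate-++ u 1 true (replicate (suc u₂) false)) ⟩
        reverse (replicate u true ++ false ∷ [])
          ≡⟨ reverse-++ (replicate u true) (false ∷ []) ⟩
        false ∷ reverse (replicate u true)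
          ≡⟨ cong (false ∷_) (reverse-replicate u true) ⟩
        false ∷ replicate u true ∎
      borrow : value (replicate u false ++ W) + V * 2 + 1 ≡ value low
      borrow = begin
        value (replicate u false ++ W) + V * 2 + 1
          ≡⟨ cong (λ x → x + V * 2 + 1) (value-replicate-++ u false W) ⟩
        value (replicate u false) + 2 ^ u * value W + V * 2 + 1
          ≡⟨ cong (λ x → x + 2 ^ u * value W + V * 2 + 1) (value-replicate-false u) ⟩
        2 ^ u * value W + V * 2 + 1
          ≡⟨ regroup (2 ^ u * value W) V ⟩
        V + 2 ^ u * value W + (V + 1)
          ≡⟨ value-low ⟩
        value low ∎
        where
        regroup : ∀ x v → x + v * 2 + 1 ≡ v + x + (v + 1)
        regroup = solve-∀
      ones-borrow : ones (replicate u false ++ W) + ones (replicate u true) + 1 ≡ t' + ones low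
      ones-borrow = begin
        ones (replicate u false ++ W) + ones (replicate u true) + 1
          ≡⟨ cong₂ (λ x y → x + y + 1) (ones-replicate-++-W false) (ones-replicate-true u) ⟩
        ones (replicate u false) + (t' + 1) + u + 1
          ≡⟨ cong (λ x → x + (t' + 1) + u + 1) (ones-replicate-false u) ⟩
        t' + 1 + u + 1
          ≡⟨ regroup u t' ⟩
        t' + (u + 2)
          ≡⟨ cong (t' +_) ones-low ⟨
        t' + ones low ∎
        where
        regroup : ∀ u t' → t' + 1 + u + 1 ≡ t' + (u + 2)
        regroup = solve-∀
      even-u : parity u ≡ 0ℙ
      even-u = trans (cong parity u≡a*2) (trans (ℙ.*-homo-* a 2) (ℙ.*-zeroʳ (parity a)))
      odd : ∀ j → j + (u + 1) ≡ len k → parity (j + t') ≡ 1ℙ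
      odd j lengths = begin
        parity (j + t')
          ≡⟨ parity-+-split j (u + 1) t' ⟩
        parity (j + (u + 1)) ℙ.+ parity (u + 1 + t')
          ≡⟨ cong₂ ℙ._+_ (trans (cong parity lengths) even-length) (ℙ.+-homo-+ (u + 1) t') ⟩
        parity (u + 1) ℙ.+ parity t'
          ≡⟨ cong₂ ℙ._+_ (trans (ℙ.+-homo-+ u 1) (cong (ℙ._+ 1ℙ) even-u)) even-gap ⟩
        1ℙ ∎

    f<k : 2 ∣ u → Σ ℕ (λ n → IsF k n × n < k)
    f<k 2∣u with parity (len k) in length-parity | parity t' in gap-parity
    ... | 1ℙ | _  = f<k-odd-length length-parity
    ... | 0ℙ | 1ℙ = f<k-even-length-odd-gap length-parity gap-parity
    ... | 0ℙ | 0ℙ = f<k-even-length-even-gap 2∣u length-parity gap-parity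

lemma6 : (k u t' : ℕ) → 1 ≤ k → 2 ≤ u → 2 ∣ u → 2 ≤ t'
         → u + t' + 2 ≤ len k → 2 * u ∸ 1 ≤ len k
         → L (u + t' + 2) k ≡ true ∷ true ∷ (pow false t' ++ pow true u)
         → U (2 * u ∸ 1) k ≡ pow true u ++ pow false (u ∸ 1)
         → Σ ℕ (λ m → IsF k m × m < k)
lemma6 k (suc (suc u₂)) t' _ (s≤s (s≤s _)) 2∣u _ long _ trailing leading =
  f<k low-split leading long 2∣u
  where
  n : ℕ
  n = suc (suc u₂) + t' + 2
  open Borrowing k u₂ t' (drop n (bitsLSB k))
  low-split : low ++ drop n (bitsLSB k) ≡ bitsLSB k
  low-split = begin
    low ++ drop n (bitsLSB k)
      ≡⟨ cong (_++ drop n (bitsLSB k)) (reverse-trailing-block u t') ⟨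
    reverse (true ∷ true ∷ (replicate t' false ++ replicate u true)) ++ drop n (bitsLSB k)
      ≡⟨ cong (λ w → reverse w ++ drop n (bitsLSB k)) trailing ⟨
    reverse (reverse (take n (bitsLSB k))) ++ drop n (bitsLSB k)
      ≡⟨ cong (_++ drop n (bitsLSB k)) (reverse-involutive (take n (bitsLSB k))) ⟩
    take n (bitsLSB k) ++ drop n (bitsLSB k)
      ≡⟨ take++drop≡id n (bitsLSB k) ⟩
    bitsLSB k ∎
    where open ≡-Reasoning
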